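{- For every oriented graph $D$: (i) $\hom_{IV}(D)\ge \tfrac18\hom(C_4,D)$; (ii) $\hom_{II}(D)\le \tfrac12\hom(C_4,D)$.
   Context: All graphs are finite and simple. For an oriented graph $H$ and an oriented graph $D$, a homomorphism from $H$ to $D$ is a map $f:V(H)\to V(D)$ such that $\vec{f(x)f(y)}$ is an arc of $D$ for every arc $\vec{xy}$ of $H$; for an unoriented graph $G$, a homomorphism from $G$ to $D$ is a map $f$ such that $f(x)f(y)$ is an edge of the underlying graph of $D$ for every edge $xy$ of $G$. $\hom(H,D)$ denotes the number of homomorphisms. $C_4$ is the unoriented cycle on vertices $1,2,3,4$ with edges $12,23,34,41$. Each of the 16 orientations of this cycle is classified as follows: call the edge $\{i,i+1\}$ (indices mod 4) forward if it is oriented from $i$ to $i+1$. Type I: 0 or 4 forward edges; Type II: 1 or 3 forward edges; Type III: exactly 2 forward edges which are consecutive around the cycle; Type IV: exactly 2 forward edges which are non-consecutive. For $T\in\{I,II,III,IV\}$, $\hom_T(D)$ is the sum of $\hom(H,D)$ over the orientations $H$ of this cycle of type $T$. -}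

module Defs where

open import Data.Nat using (ℕ; zero; suc; _+_; _*_; _≡ᵇ_)
open import Data.Bool using (Bool; true; false; if_then_else_; _∧_; _∨_; not)
open import Data.Fin using (Fin; zero; suc)
open import Data.List using (List; map; allFin)
open import Data.Nat.ListAction using (sum)
open import Relation.Binary.PropositionalEquality using (_≡_)

record OrientedGraph (n : ℕ) : Set where
  field
    arc        : Fin n → Fin n → Bool
    irreflexive : ∀ x → arc x x ≡ false
    antisym    : ∀ x y → arc x y ≡ true → arc y x ≡ false

open OrientedGraph public

Σ[_] : (n : ℕ) → (Fin n → ℕ) → ℕ
Σ[ n ] f = sum (map f (allFin n))

ΣB : (Bool → ℕ) → ℕ
ΣB f = f true + f false

𝟙 : Bool → ℕ
𝟙 true  = 1
𝟙 false = 0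

edge : ∀ {n} → OrientedGraph n → Fin n → Fin n → Bool
edge D x y = arc D x y ∨ arc D y x

homC4 : ∀ {n} → OrientedGraph n → ℕ
homC4 {n} D =
  Σ[ n ] λ a → Σ[ n ] λ b → Σ[ n ] λ c → Σ[ n ] λ d →
    𝟙 (edge D a b) * 𝟙 (edge D b c) * 𝟙 (edge D c d) * 𝟙 (edge D d a)

-- An orientation of C₄ is given by four Booleans f₁ f₂ f₃ f₄, where fᵢ = true
-- means the edge {i,i+1} (indices mod 4) is forward, i.e. oriented i → i+1.
-- Indicator that x→y is an arc of D when forward, y→x when backward.
dirArc : ∀ {n} → OrientedGraph n → Bool → Fin n → Fin n → Bool
dirArc D true  x y = arc D x y
dirArc D false x y = arc D y x

homOr : ∀ {n} → OrientedGraph n → Bool → Bool → Bool → Bool → ℕ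
homOr {n} D f₁ f₂ f₃ f₄ =
  Σ[ n ] λ a → Σ[ n ] λ b → Σ[ n ] λ c → Σ[ n ] λ d →
    𝟙 (dirArc D f₁ a b) * 𝟙 (dirArc D f₂ b c) * 𝟙 (dirArc D f₃ c d) * 𝟙 (dirArc D f₄ d a)

forwardCount : Bool → Bool → Bool → Bool → ℕ
forwardCount f₁ f₂ f₃ f₄ = 𝟙 f₁ + 𝟙 f₂ + 𝟙 f₃ + 𝟙 f₄

someConsecutive : Bool → Bool → Bool → Bool → Bool
someConsecutive f₁ f₂ f₃ f₄ = (f₁ ∧ f₂) ∨ (f₂ ∧ f₃) ∨ (f₃ ∧ f₄) ∨ (f₄ ∧ f₁)

isTypeII : Bool → Bool → Bool → Bool → Bool
isTypeII f₁ f₂ f₃ f₄ =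
  (forwardCount f₁ f₂ f₃ f₄ ≡ᵇ 1) ∨ (forwardCount f₁ f₂ f₃ f₄ ≡ᵇ 3)

isTypeIV : Bool → Bool → Bool → Bool → Bool
isTypeIV f₁ f₂ f₃ f₄ =
  (forwardCount f₁ f₂ f₃ f₄ ≡ᵇ 2) ∧ not (someConsecutive f₁ f₂ f₃ f₄)

homType : ∀ {n} → (Bool → Bool → Bool → Bool → Bool) → OrientedGraph n → ℕ
homType T D =
  ΣB λ f₁ → ΣB λ f₂ → ΣB λ f₃ → ΣB λ f₄ →
    𝟙 (T f₁ f₂ f₃ f₄) * homOr D f₁ f₂ f₃ f₄

homII : ∀ {n} → OrientedGraph n → ℕ
homII = homType isTypeII

homIV : ∀ {n} → OrientedGraph n → ℕ
homIV = homType isTypeIV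

module Submission where

-- Let A be the 0/1 adjacency matrix of D, ⊙ the matrix product and
-- ⟪P , Q⟫ = Σ_{a,c} P a c · Q a c the Frobenius inner product.  The hom count
-- of an orientation of C₄ with edge matrices g₁ … g₄ (each A or Aᵀ) is a sum
-- over closed walks a b c d; splitting it at a and c gives
-- ⟪ g₁ ⊙ g₂ , g₄ᵀ ⊙ g₃ᵀ ⟫.  With the two-step walk matrices
--   U = A⊙A,  V = Aᵀ⊙Aᵀ  (directed paths)   X = A⊙Aᵀ,  Y = Aᵀ⊙A  (turning paths)
-- this gives hom_IV = ⟪X,X⟫ + ⟪Y,Y⟫ and hom_II = 2⟪X⊕Y , U⊕V⟫, and, since the
-- underlying graph has adjacency matrix A + Aᵀ, hom(C₄) = ⟪W,W⟫ with
-- W = (X⊕Y) ⊕ (U⊕V).  Rotating the closed walk shows ⟪U,U⟫ = ⟪V,V⟫ = ⟪X,Y⟫.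
-- Both inequalities then follow from 2⟪P,Q⟫ ≤ ⟪P,P⟫ + ⟪Q,Q⟫.

open import Defs
open import Data.Nat using (ℕ; _*_; _≤_)
open import Data.Product using (_×_)

open import Data.Nat using (zero; suc; _+_)
open import Data.Nat.Properties
  using (+-*-semiring; +-comm; *-comm; *-assoc; *-distribˡ-+; *-distribʳ-+;
         +-mono-≤; +-monoˡ-≤; +-monoʳ-≤; *-monoʳ-≤; ≤-refl; ≤-total; m≤m+n; m≤n⇒∃[o]m+o≡n;
         module ≤-Reasoning)
open import Data.Nat.Tactic.RingSolver using (solve-∀)
open import Data.Bool using (Bool; true; false)
open import Data.Bool.Properties using (∨-comm)
open import Data.Fin using (Fin; zero; suc)
open import Data.List using (tabulate)
open import Data.List.Properties using (map-tabulate)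
import Data.Nat.ListAction as List
open import Data.Product using (_,_)
open import Data.Sum using (inj₁; inj₂)
open import Function using (id)
open import Relation.Binary.PropositionalEquality
  using (_≡_; refl; sym; trans; cong; cong₂; subst; subst₂; module ≡-Reasoning)
open import Algebra.Properties.Semiring.Sum +-*-semiring
  using (sum; sum-syntax; sum-cong-≗; ∑-distrib-+; ∑-comm; *-distribˡ-sum; *-distribʳ-sum)

-- For p ≤ q, writing q = p + k gives p² + q² = 2pq + k².
amgm-ordered : ∀ {p q} → p ≤ q → 2 * (p * q) ≤ p * p + q * q
amgm-ordered {p} p≤q with m≤n⇒∃[o]m+o≡n p≤q
... | k , refl = subst (2 * (p * (p + k)) ≤_) (sym (expand p k)) (m≤m+n _ (k * k))
  where
  expand : ∀ p k → p * p + (p + k) * (p + k) ≡ 2 * (p * (p + k)) + k * k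
  expand = solve-∀

amgm : ∀ p q → 2 * (p * q) ≤ p * p + q * q
amgm p q with ≤-total p q
... | inj₁ p≤q = amgm-ordered p≤q
... | inj₂ q≤p = subst₂ _≤_ (cong (2 *_) (*-comm q p)) (+-comm (q * q) (p * p)) (amgm-ordered q≤p)

module _ {n : ℕ} where

  Σ≡∑ : (f : Fin n → ℕ) → Σ[ n ] f ≡ sum f
  Σ≡∑ f = trans (cong List.sum (map-tabulate id f)) (listSum-tabulate f)
    where
    listSum-tabulate : ∀ {m} (g : Fin m → ℕ) → List.sum (tabulate g) ≡ sum g
    listSum-tabulate {zero}  g = refl
    listSum-tabulate {suc m} g = cong (g zero +_) (listSum-tabulate (λ i → g (suc i)))

  Σ≡∑-cong : {f g : Fin n → ℕ} → (∀ i → f i ≡ g i) → Σ[ n ] f ≡ sum g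
  Σ≡∑-cong {f} f≗g = trans (Σ≡∑ f) (sum-cong-≗ f≗g)

  ∑-mono : ∀ {m} {f g : Fin m → ℕ} → (∀ i → f i ≤ g i) → sum f ≤ sum g
  ∑-mono {zero}  f≤g = ≤-refl
  ∑-mono {suc m} f≤g = +-mono-≤ (f≤g zero) (∑-mono (λ i → f≤g (suc i)))

  ∑-product : (x y : Fin n → ℕ) → sum x * sum y ≡ ∑[ i < n ] ∑[ j < n ] (x i * y j)
  ∑-product x y = trans (*-distribʳ-sum (sum y) x) (sum-cong-≗ λ i → *-distribˡ-sum (x i) y)

  ∑∑ : (Fin n → Fin n → ℕ) → ℕ
  ∑∑ F = ∑[ a < n ] ∑[ c < n ] F a c

  ∑∑-cong : {F G : Fin n → Fin n → ℕ} → (∀ a c → F a c ≡ G a c) → ∑∑ F ≡ ∑∑ G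
  ∑∑-cong F≗G = sum-cong-≗ λ a → sum-cong-≗ (F≗G a)

  ∑∑-mono : {F G : Fin n → Fin n → ℕ} → (∀ a c → F a c ≤ G a c) → ∑∑ F ≤ ∑∑ G
  ∑∑-mono F≤G = ∑-mono λ a → ∑-mono (F≤G a)

  ∑∑-distrib-+ : (F G : Fin n → Fin n → ℕ) → ∑∑ (λ a c → F a c + G a c) ≡ ∑∑ F + ∑∑ G
  ∑∑-distrib-+ F G = trans (sum-cong-≗ λ a → ∑-distrib-+ (F a) (G a)) (∑-distrib-+ (λ a → ∑[ c < n ] F a c) (λ a → ∑[ c < n ] G a c))

  ∑∑-scale : (k : ℕ) (F : Fin n → Fin n → ℕ) → k * ∑∑ F ≡ ∑∑ (λ a c → k * F a c)
  ∑∑-scale k F = trans (*-distribˡ-sum k (λ a → ∑[ c < n ] F a c)) (sum-cong-≗ λ a → *-distribˡ-sum k (F a))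

Matrix : ℕ → Set
Matrix n = Fin n → Fin n → ℕ

module _ {n : ℕ} where

  infix  4 _≈_
  infixl 6 _⊕_
  infixl 7 _⊙_
  infixl 8 _ᵀ

  _ᵀ : Matrix n → Matrix n
  (P ᵀ) a c = P c a

  _⊕_ : Matrix n → Matrix n → Matrix n
  (P ⊕ Q) a c = P a c + Q a c

  _⊙_ : Matrix n → Matrix n → Matrix n
  (P ⊙ Q) a c = ∑[ b < n ] (P a b * Q b c)

  _≈_ : Matrix n → Matrix n → Set
  P ≈ Q = ∀ a c → P a c ≡ Q a c

  ⟪_,_⟫ : Matrix n → Matrix n → ℕ
  ⟪ P , Q ⟫ = ∑∑ (λ a c → P a c * Q a c)

  ⊙-cong : {P P′ Q Q′ : Matrix n} → P ≈ P′ → Q ≈ Q′ → P ⊙ Q ≈ P′ ⊙ Q′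
  ⊙-cong P≈P′ Q≈Q′ a c = sum-cong-≗ λ b → cong₂ _*_ (P≈P′ a b) (Q≈Q′ b c)

  ⊙-transpose : (P Q : Matrix n) → (P ⊙ Q) ᵀ ≈ Q ᵀ ⊙ P ᵀ
  ⊙-transpose P Q a c = sum-cong-≗ λ b → *-comm (P c b) (Q b a)

  ⟪⟫-cong : {P P′ Q Q′ : Matrix n} → P ≈ P′ → Q ≈ Q′ → ⟪ P , Q ⟫ ≡ ⟪ P′ , Q′ ⟫
  ⟪⟫-cong P≈P′ Q≈Q′ = ∑∑-cong λ a c → cong₂ _*_ (P≈P′ a c) (Q≈Q′ a c)

  ⟪⟫-comm : (P Q : Matrix n) → ⟪ P , Q ⟫ ≡ ⟪ Q , P ⟫
  ⟪⟫-comm P Q = ∑∑-cong λ a c → *-comm (P a c) (Q a c)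

  ⟪⟫-transpose : (P Q : Matrix n) → ⟪ P ᵀ , Q ᵀ ⟫ ≡ ⟪ P , Q ⟫
  ⟪⟫-transpose P Q = ∑-comm (λ a c → P c a * Q c a)

  ⟪⟫-distribˡ : (P Q R : Matrix n) → ⟪ P , Q ⊕ R ⟫ ≡ ⟪ P , Q ⟫ + ⟪ P , R ⟫
  ⟪⟫-distribˡ P Q R =
    trans (∑∑-cong λ a c → *-distribˡ-+ (P a c) (Q a c) (R a c))
          (∑∑-distrib-+ (λ a c → P a c * Q a c) (λ a c → P a c * R a c))

  ⟪⟫-distribʳ : (P Q R : Matrix n) → ⟪ P ⊕ Q , R ⟫ ≡ ⟪ P , R ⟫ + ⟪ Q , R ⟫
  ⟪⟫-distribʳ P Q R =
    trans (∑∑-cong λ a c → *-distribʳ-+ (R a c) (P a c) (Q a c))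
          (∑∑-distrib-+ (λ a c → P a c * R a c) (λ a c → Q a c * R a c))

  ⟪⟫-amgm : (P Q : Matrix n) → 2 * ⟪ P , Q ⟫ ≤ ⟪ P , P ⟫ + ⟪ Q , Q ⟫
  ⟪⟫-amgm P Q = begin
    2 * ⟪ P , Q ⟫                                        ≡⟨ ∑∑-scale 2 (λ a c → P a c * Q a c) ⟩
    ∑∑ (λ a c → 2 * (P a c * Q a c))                     ≤⟨ ∑∑-mono (λ a c → amgm (P a c) (Q a c)) ⟩
    ∑∑ (λ a c → P a c * P a c + Q a c * Q a c)           ≡⟨ ∑∑-distrib-+ (λ a c → P a c * P a c) (λ a c → Q a c * Q a c) ⟩
    ⟪ P , P ⟫ + ⟪ Q , Q ⟫                                ∎
    where open ≤-Reasoning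

  ⟪⊕⟫-square : (P Q : Matrix n) → ⟪ P ⊕ Q , P ⊕ Q ⟫ ≡ ⟪ P , P ⟫ + 2 * ⟪ P , Q ⟫ + ⟪ Q , Q ⟫
  ⟪⊕⟫-square P Q = begin
    ⟪ P ⊕ Q , P ⊕ Q ⟫                                    ≡⟨ ⟪⟫-distribʳ P Q (P ⊕ Q) ⟩
    ⟪ P , P ⊕ Q ⟫ + ⟪ Q , P ⊕ Q ⟫                        ≡⟨ cong₂ _+_ (⟪⟫-distribˡ P P Q) (⟪⟫-distribˡ Q P Q) ⟩
    (⟪ P , P ⟫ + ⟪ P , Q ⟫) + (⟪ Q , P ⟫ + ⟪ Q , Q ⟫)    ≡⟨ cong (λ t → (⟪ P , P ⟫ + ⟪ P , Q ⟫) + (t + ⟪ Q , Q ⟫)) (⟪⟫-comm Q P) ⟩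
    (⟪ P , P ⟫ + ⟪ P , Q ⟫) + (⟪ P , Q ⟫ + ⟪ Q , Q ⟫)    ≡⟨ regroup ⟪ P , P ⟫ ⟪ P , Q ⟫ ⟪ Q , Q ⟫ ⟩
    ⟪ P , P ⟫ + 2 * ⟪ P , Q ⟫ + ⟪ Q , Q ⟫                ∎
    where
    open ≡-Reasoning
    regroup : ∀ p m q → (p + m) + (m + q) ≡ p + 2 * m + q
    regroup = solve-∀

  ⟪⊕⟫-upper : (P Q : Matrix n) → ⟪ P ⊕ Q , P ⊕ Q ⟫ ≤ 2 * (⟪ P , P ⟫ + ⟪ Q , Q ⟫)
  ⟪⊕⟫-upper P Q = begin
    ⟪ P ⊕ Q , P ⊕ Q ⟫                                    ≡⟨ ⟪⊕⟫-square P Q ⟩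
    ⟪ P , P ⟫ + 2 * ⟪ P , Q ⟫ + ⟪ Q , Q ⟫                ≤⟨ +-monoˡ-≤ ⟪ Q , Q ⟫ (+-monoʳ-≤ ⟪ P , P ⟫ (⟪⟫-amgm P Q)) ⟩
    ⟪ P , P ⟫ + (⟪ P , P ⟫ + ⟪ Q , Q ⟫) + ⟪ Q , Q ⟫      ≡⟨ regroup ⟪ P , P ⟫ ⟪ Q , Q ⟫ ⟩
    2 * (⟪ P , P ⟫ + ⟪ Q , Q ⟫)                          ∎
    where
    open ≤-Reasoning
    regroup : ∀ p q → p + (p + q) + q ≡ 2 * (p + q)
    regroup = solve-∀

  ⟪⊕⟫-lower : (P Q : Matrix n) → 4 * ⟪ P , Q ⟫ ≤ ⟪ P ⊕ Q , P ⊕ Q ⟫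
  ⟪⊕⟫-lower P Q = begin
    4 * ⟪ P , Q ⟫                                        ≡⟨ regroup ⟪ P , Q ⟫ ⟩
    2 * ⟪ P , Q ⟫ + 2 * ⟪ P , Q ⟫                        ≤⟨ +-monoˡ-≤ (2 * ⟪ P , Q ⟫) (⟪⟫-amgm P Q) ⟩
    ⟪ P , P ⟫ + ⟪ Q , Q ⟫ + 2 * ⟪ P , Q ⟫                ≡⟨ swap ⟪ P , P ⟫ ⟪ Q , Q ⟫ (2 * ⟪ P , Q ⟫) ⟩
    ⟪ P , P ⟫ + 2 * ⟪ P , Q ⟫ + ⟪ Q , Q ⟫                ≡⟨ sym (⟪⊕⟫-square P Q) ⟩
    ⟪ P ⊕ Q , P ⊕ Q ⟫                                    ∎
    where
    open ≤-Reasoning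
    regroup : ∀ m → 4 * m ≡ 2 * m + 2 * m
    regroup = solve-∀
    swap : ∀ p q r → p + q + r ≡ p + r + q
    swap = solve-∀

  closedWalks : (g₁ g₂ g₃ g₄ : Matrix n) → ℕ
  closedWalks g₁ g₂ g₃ g₄ =
    ∑[ a < n ] ∑[ b < n ] ∑[ c < n ] ∑[ d < n ] (g₁ a b * g₂ b c * g₃ c d * g₄ d a)

  closedWalks-Σ : (g₁ g₂ g₃ g₄ : Matrix n) →
    (Σ[ n ] λ a → Σ[ n ] λ b → Σ[ n ] λ c → Σ[ n ] λ d → g₁ a b * g₂ b c * g₃ c d * g₄ d a)
    ≡ closedWalks g₁ g₂ g₃ g₄
  closedWalks-Σ g₁ g₂ g₃ g₄ =
    Σ≡∑-cong λ a → Σ≡∑-cong λ b → Σ≡∑-cong λ c → Σ≡∑ (λ d → g₁ a b * g₂ b c * g₃ c d * g₄ d a)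

  -- Splitting a closed walk at a and c: it is a walk a b c followed by the
  -- reverse of a walk a d c.
  closedWalks-pairing : (g₁ g₂ g₃ g₄ : Matrix n) →
    closedWalks g₁ g₂ g₃ g₄ ≡ ⟪ g₁ ⊙ g₂ , g₄ ᵀ ⊙ g₃ ᵀ ⟫
  closedWalks-pairing g₁ g₂ g₃ g₄ = begin
    closedWalks g₁ g₂ g₃ g₄
      ≡⟨ sum-cong-≗ (λ a → ∑-comm (λ b c → ∑[ d < n ] (g₁ a b * g₂ b c * g₃ c d * g₄ d a))) ⟩
    ∑[ a < n ] ∑[ c < n ] ∑[ b < n ] ∑[ d < n ] (g₁ a b * g₂ b c * g₃ c d * g₄ d a)
      ≡⟨ ∑∑-cong (λ a c → sum-cong-≗ λ b → sum-cong-≗ λ d →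
           *-assoc (g₁ a b * g₂ b c) (g₃ c d) (g₄ d a)) ⟩
    ∑[ a < n ] ∑[ c < n ] ∑[ b < n ] ∑[ d < n ] ((g₁ a b * g₂ b c) * (g₃ c d * g₄ d a))
      ≡⟨ ∑∑-cong (λ a c → sym (∑-product (λ b → g₁ a b * g₂ b c) (λ d → g₃ c d * g₄ d a))) ⟩
    ⟪ g₁ ⊙ g₂ , (g₃ ⊙ g₄) ᵀ ⟫
      ≡⟨ ⟪⟫-cong {P = g₁ ⊙ g₂} (λ a c → refl) (⊙-transpose g₃ g₄) ⟩
    ⟪ g₁ ⊙ g₂ , g₄ ᵀ ⊙ g₃ ᵀ ⟫
      ∎
    where open ≡-Reasoning

  closedWalks-rotate : (g₁ g₂ g₃ g₄ : Matrix n) →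
    closedWalks g₁ g₂ g₃ g₄ ≡ closedWalks g₂ g₃ g₄ g₁
  closedWalks-rotate g₁ g₂ g₃ g₄ = begin
    ∑[ a < n ] ∑[ b < n ] ∑[ c < n ] ∑[ d < n ] walk a b c d
      ≡⟨ ∑-comm (λ a b → ∑[ c < n ] ∑[ d < n ] walk a b c d) ⟩
    ∑[ b < n ] ∑[ a < n ] ∑[ c < n ] ∑[ d < n ] walk a b c d
      ≡⟨ sum-cong-≗ (λ b → ∑-comm (λ a c → ∑[ d < n ] walk a b c d)) ⟩
    ∑[ b < n ] ∑[ c < n ] ∑[ a < n ] ∑[ d < n ] walk a b c d
      ≡⟨ ∑∑-cong (λ b c → ∑-comm (λ a d → walk a b c d)) ⟩
    ∑[ b < n ] ∑[ c < n ] ∑[ d < n ] ∑[ a < n ] walk a b c d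
      ≡⟨ ∑∑-cong (λ b c → sum-cong-≗ λ d → sum-cong-≗ λ a →
           rotate (g₁ a b) (g₂ b c) (g₃ c d) (g₄ d a)) ⟩
    closedWalks g₂ g₃ g₄ g₁
      ∎
    where
    open ≡-Reasoning
    walk : Fin n → Fin n → Fin n → Fin n → ℕ
    walk a b c d = g₁ a b * g₂ b c * g₃ c d * g₄ d a
    rotate : ∀ x y z w → x * y * z * w ≡ y * z * w * x
    rotate = solve-∀

orientationSum : (isType : Bool → Bool → Bool → Bool → Bool) → (Bool → Bool → Bool → Bool → ℕ) → ℕ
orientationSum isType h =
  ΣB λ f₁ → ΣB λ f₂ → ΣB λ f₃ → ΣB λ f₄ → 𝟙 (isType f₁ f₂ f₃ f₄) * h f₁ f₂ f₃ f₄

orientationSum-cong : (isType : Bool → Bool → Bool → Bool → Bool) {h h′ : Bool → Bool → Bool → Bool → ℕ} →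
  (∀ f₁ f₂ f₃ f₄ → h f₁ f₂ f₃ f₄ ≡ h′ f₁ f₂ f₃ f₄) → orientationSum isType h ≡ orientationSum isType h′
orientationSum-cong isType h≗h′ =
  ΣB-cong λ f₁ → ΣB-cong λ f₂ → ΣB-cong λ f₃ → ΣB-cong λ f₄ →
    cong (𝟙 (isType f₁ f₂ f₃ f₄) *_) (h≗h′ f₁ f₂ f₃ f₄)
  where
  ΣB-cong : {f g : Bool → ℕ} → (∀ b → f b ≡ g b) → ΣB f ≡ ΣB g
  ΣB-cong f≗g = cong₂ _+_ (f≗g true) (f≗g false)

private
  pattern T = true
  pattern F = false

-- In the proofs of this
-- and the next lemma the sum is unfolded into its 16 terms (in lexicographic
-- order of f₁ f₂ f₃ f₄, with the type indicators evaluated).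
typeIV-orientations : (h : Bool → Bool → Bool → Bool → ℕ) →
  orientationSum isTypeIV h ≡ h T F T F + h F T F T
typeIV-orientations h =
  table (h T T T T) (h T T T F) (h T T F T) (h T T F F) (h T F T T) (h T F T F) (h T F F T) (h T F F F)
        (h F T T T) (h F T T F) (h F T F T) (h F T F F) (h F F T T) (h F F T F) (h F F F T) (h F F F F)
  where
  table : ∀ a₁ a₂ a₃ a₄ a₅ a₆ a₇ a₈ a₉ a₁₀ a₁₁ a₁₂ a₁₃ a₁₄ a₁₅ a₁₆ →
    (((0 * a₁ + 0 * a₂) + (0 * a₃ + 0 * a₄)) + ((0 * a₅ + 1 * a₆) + (0 * a₇ + 0 * a₈)))
    + (((0 * a₉ + 0 * a₁₀) + (1 * a₁₁ + 0 * a₁₂)) + ((0 * a₁₃ + 0 * a₁₄) + (0 * a₁₅ + 0 * a₁₆)))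
    ≡ a₆ + a₁₁
  table = solve-∀

-- The orientations of type II (one or three forward edges), grouped in pairs
-- that share their first two edges or their last two edges.
typeII-orientations : (h : Bool → Bool → Bool → Bool → ℕ) →
  orientationSum isTypeII h
  ≡ ((h T F F F + h T F T T) + (h F T F F + h F T T T)) + ((h T T T F + h F F T F) + (h T T F T + h F F F T))
typeII-orientations h =
  table (h T T T T) (h T T T F) (h T T F T) (h T T F F) (h T F T T) (h T F T F) (h T F F T) (h T F F F)
        (h F T T T) (h F T T F) (h F T F T) (h F T F F) (h F F T T) (h F F T F) (h F F F T) (h F F F F)
  where
  table : ∀ a₁ a₂ a₃ a₄ a₅ a₆ a₇ a₈ a₉ a₁₀ a₁₁ a₁₂ a₁₃ a₁₄ a₁₅ a₁₆ →
    (((0 * a₁ + 1 * a₂) + (1 * a₃ + 0 * a₄)) + ((1 * a₅ + 0 * a₆) + (0 * a₇ + 1 * a₈)))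
    + (((1 * a₉ + 0 * a₁₀) + (0 * a₁₁ + 1 * a₁₂)) + ((0 * a₁₃ + 1 * a₁₄) + (1 * a₁₅ + 0 * a₁₆)))
    ≡ ((a₈ + a₅) + (a₁₂ + a₉)) + ((a₂ + a₁₄) + (a₃ + a₁₅))
  table = solve-∀

module WalkMatrices {n : ℕ} (D : OrientedGraph n) where

  A : Matrix n
  A x y = 𝟙 (arc D x y)

  oriented : Bool → Matrix n
  oriented f x y = 𝟙 (dirArc D f x y)

  E : Matrix n
  E x y = 𝟙 (edge D x y)

  U V X Y : Matrix n
  U = A ⊙ A
  V = A ᵀ ⊙ A ᵀ
  X = A ⊙ A ᵀ
  Y = A ᵀ ⊙ A

  turning directed : Matrix n
  turning  = X ⊕ Y
  directed = U ⊕ V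

  pairing : Bool → Bool → Bool → Bool → ℕ
  pairing f₁ f₂ f₃ f₄ = ⟪ oriented f₁ ⊙ oriented f₂ , oriented f₄ ᵀ ⊙ oriented f₃ ᵀ ⟫

  homOr-pairing : ∀ f₁ f₂ f₃ f₄ → homOr D f₁ f₂ f₃ f₄ ≡ pairing f₁ f₂ f₃ f₄
  homOr-pairing f₁ f₂ f₃ f₄ =
    trans (closedWalks-Σ (oriented f₁) (oriented f₂) (oriented f₃) (oriented f₄))
          (closedWalks-pairing (oriented f₁) (oriented f₂) (oriented f₃) (oriented f₄))

  homType-pairing : (isType : Bool → Bool → Bool → Bool → Bool) →
    homType isType D ≡ orientationSum isType pairing
  homType-pairing isType = orientationSum-cong isType homOr-pairing

  homIV-value : homIV D ≡ ⟪ X , X ⟫ + ⟪ Y , Y ⟫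
  homIV-value = trans (homType-pairing isTypeIV) (typeIV-orientations pairing)

  homII-value : homII D ≡ 2 * ⟪ turning , directed ⟫
  homII-value = begin
    homII D
      ≡⟨ trans (homType-pairing isTypeII) (typeII-orientations pairing) ⟩
    ((⟪ X , U ⟫ + ⟪ X , V ⟫) + (⟪ Y , U ⟫ + ⟪ Y , V ⟫)) + ((⟪ U , X ⟫ + ⟪ V , X ⟫) + (⟪ U , Y ⟫ + ⟪ V , Y ⟫))
      ≡⟨ sym (cong₂ _+_ (cong₂ _+_ (⟪⟫-distribˡ X U V) (⟪⟫-distribˡ Y U V))
                        (cong₂ _+_ (⟪⟫-distribʳ U V X) (⟪⟫-distribʳ U V Y))) ⟩
    (⟪ X , directed ⟫ + ⟪ Y , directed ⟫) + (⟪ directed , X ⟫ + ⟪ directed , Y ⟫)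
      ≡⟨ sym (cong₂ _+_ (⟪⟫-distribʳ X Y directed) (⟪⟫-distribˡ directed X Y)) ⟩
    ⟪ turning , directed ⟫ + ⟪ directed , turning ⟫
      ≡⟨ cong (⟪ turning , directed ⟫ +_) (⟪⟫-comm directed turning) ⟩
    ⟪ turning , directed ⟫ + ⟪ turning , directed ⟫
      ≡⟨ double ⟪ turning , directed ⟫ ⟩
    2 * ⟪ turning , directed ⟫
      ∎
    where
    open ≡-Reasoning
    double : ∀ k → k + k ≡ 2 * k
    double = solve-∀

  -- By antisymmetry at most one of x → y, y → x is an arc, so E = A + Aᵀ.
  edge-split : ∀ x y → E x y ≡ A x y + A y x
  edge-split x y with arc D x y in xy
  ... | true rewrite antisym D x y xy = refl
  ... | false = refl

  E-symmetric : E ᵀ ≈ E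
  E-symmetric a c = cong 𝟙 (∨-comm (arc D c a) (arc D a c))

  E-square : E ⊙ E ≈ turning ⊕ directed
  E-square a c = begin
    ∑[ b < n ] (E a b * E b c)
      ≡⟨ sum-cong-≗ (λ b → cong₂ _*_ (edge-split a b) (edge-split b c)) ⟩
    ∑[ b < n ] ((A a b + A b a) * (A b c + A c b))
      ≡⟨ sum-cong-≗ (λ b → expand (A a b) (A b a) (A b c) (A c b)) ⟩
    ∑[ b < n ] ((A a b * A c b + A b a * A b c) + (A a b * A b c + A b a * A c b))
      ≡⟨ ∑-distrib-+ (λ b → A a b * A c b + A b a * A b c) (λ b → A a b * A b c + A b a * A c b) ⟩
    ∑[ b < n ] (A a b * A c b + A b a * A b c) + ∑[ b < n ] (A a b * A b c + A b a * A c b)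
      ≡⟨ cong₂ _+_ (∑-distrib-+ (λ b → A a b * A c b) (λ b → A b a * A b c))
                   (∑-distrib-+ (λ b → A a b * A b c) (λ b → A b a * A c b)) ⟩
    (turning ⊕ directed) a c
      ∎
    where
    open ≡-Reasoning
    expand : ∀ p q r s → (p + q) * (r + s) ≡ (p * s + q * r) + (p * r + q * s)
    expand = solve-∀

  homC4-value : homC4 D ≡ ⟪ turning ⊕ directed , turning ⊕ directed ⟫
  homC4-value = begin
    homC4 D                                ≡⟨ closedWalks-Σ E E E E ⟩
    closedWalks E E E E                    ≡⟨ closedWalks-pairing E E E E ⟩
    ⟪ E ⊙ E , E ᵀ ⊙ E ᵀ ⟫                  ≡⟨ ⟪⟫-cong E-square (λ a c →
                                                trans (⊙-cong E-symmetric E-symmetric a c) (E-square a c)) ⟩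
    ⟪ turning ⊕ directed , turning ⊕ directed ⟫ ∎
    where open ≡-Reasoning

  -- Rotating the closed walks a → b → c ← d ← a by one step: ⟪U,U⟫ = ⟪X,Y⟫.
  U-norm : ⟪ U , U ⟫ ≡ ⟪ X , Y ⟫
  U-norm = begin
    ⟪ U , U ⟫                      ≡⟨ sym (closedWalks-pairing A A (A ᵀ) (A ᵀ)) ⟩
    closedWalks A A (A ᵀ) (A ᵀ)    ≡⟨ closedWalks-rotate A A (A ᵀ) (A ᵀ) ⟩
    closedWalks A (A ᵀ) (A ᵀ) A    ≡⟨ closedWalks-pairing A (A ᵀ) (A ᵀ) A ⟩
    ⟪ X , Y ⟫                      ∎
    where open ≡-Reasoning

  -- V = Uᵀ, so V and U have the same norm.
  V-norm : ⟪ V , V ⟫ ≡ ⟪ U , U ⟫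
  V-norm = trans (⟪⟫-cong V≈Uᵀ V≈Uᵀ) (⟪⟫-transpose U U)
    where
    V≈Uᵀ : V ≈ U ᵀ
    V≈Uᵀ a c = sym (⊙-transpose A A a c)

  turning-bound : ⟪ turning , turning ⟫ ≤ 2 * homIV D
  turning-bound = begin
    ⟪ X ⊕ Y , X ⊕ Y ⟫                ≤⟨ ⟪⊕⟫-upper X Y ⟩
    2 * (⟪ X , X ⟫ + ⟪ Y , Y ⟫)      ≡⟨ cong (2 *_) (sym homIV-value) ⟩
    2 * homIV D                      ∎
    where open ≤-Reasoning

  directed-bound : ⟪ directed , directed ⟫ ≤ 2 * homIV D
  directed-bound = begin
    ⟪ U ⊕ V , U ⊕ V ⟫                ≤⟨ ⟪⊕⟫-upper U V ⟩
    2 * (⟪ U , U ⟫ + ⟪ V , V ⟫)      ≡⟨ cong (λ t → 2 * (⟪ U , U ⟫ + t)) V-norm ⟩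
    2 * (⟪ U , U ⟫ + ⟪ U , U ⟫)      ≡⟨ cong (λ t → 2 * (t + t)) U-norm ⟩
    2 * (⟪ X , Y ⟫ + ⟪ X , Y ⟫)      ≡⟨ cong (2 *_) (double ⟪ X , Y ⟫) ⟩
    2 * (2 * ⟪ X , Y ⟫)              ≤⟨ *-monoʳ-≤ 2 (⟪⟫-amgm X Y) ⟩
    2 * (⟪ X , X ⟫ + ⟪ Y , Y ⟫)      ≡⟨ cong (2 *_) (sym homIV-value) ⟩
    2 * homIV D                      ∎
    where
    open ≤-Reasoning
    double : ∀ k → k + k ≡ 2 * k
    double = solve-∀

proposition3p1 : ∀ (n : ℕ) (D : OrientedGraph n) →
    (homC4 D ≤ 8 * homIV D) × (2 * homII D ≤ homC4 D)
proposition3p1 n D = part-i , part-ii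
  where
  open WalkMatrices D
  open ≤-Reasoning

  W : Matrix n
  W = turning ⊕ directed

  part-i : homC4 D ≤ 8 * homIV D
  part-i = begin
    homC4 D                                        ≡⟨ homC4-value ⟩
    ⟪ W , W ⟫                                      ≤⟨ ⟪⊕⟫-upper turning directed ⟩
    2 * (⟪ turning , turning ⟫ + ⟪ directed , directed ⟫)
                                                   ≤⟨ *-monoʳ-≤ 2 (+-mono-≤ turning-bound directed-bound) ⟩
    2 * (2 * homIV D + 2 * homIV D)                ≡⟨ eight (homIV D) ⟩
    8 * homIV D                                    ∎
    where
    eight : ∀ h → 2 * (2 * h + 2 * h) ≡ 8 * h
    eight = solve-∀

  part-ii : 2 * homII D ≤ homC4 D
  part-ii = begin
    2 * homII D                                    ≡⟨ cong (2 *_) homII-value ⟩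
    2 * (2 * ⟪ turning , directed ⟫)               ≡⟨ sym (*-assoc 2 2 ⟪ turning , directed ⟫) ⟩
    4 * ⟪ turning , directed ⟫                     ≤⟨ ⟪⊕⟫-lower turning directed ⟩
    ⟪ W , W ⟫                                      ≡⟨ sym homC4-value ⟩
    homC4 D                                        ∎
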